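{- Let $k\ge 0$ and let $\pi^\varepsilon$ be a peg basis permutation of $\hat B_k^{(rd)}$, i.e. a peg permutation not in $\hat B_k^{(rd)}$ all of whose proper patterns (in the peg pattern order) lie in $\hat B_k^{(rd)}$. Then $\pi^\varepsilon$ is compact.
   Context: A peg permutation of length $n$ is a word $\pi_1^{\varepsilon_1}\cdots\pi_n^{\varepsilon_n}$ with $\pi_1\cdots\pi_n$ a permutation of $\{1,\dots,n\}$ in one-line notation and $\varepsilon_i\in\{+,-,\bullet\}$. An increasing (resp. decreasing) strip is a maximal factor of consecutive positions in which each value is one more (resp. one less) than the previous and all entries are decorated $+$ or $\bullet$ (resp. $-$ or $\bullet$). A peg permutation is compact if each of its strips either has length $1$ or consists only of entries decorated $\bullet$. A reversal of a peg permutation reverses a factor and swaps $+\leftrightarrow-$ on the reversed entries ($\bullet$ unchanged); $rd(\pi^\varepsilon)$ is the minimum number of reversals turning $\pi^\varepsilon$ into a peg permutation with identity underlying permutation and decorations in $\{+,\bullet\}$; $\hat B_k^{(rd)}$ is the set of peg permutations with $rd\le k$. Peg pattern order: $\sigma^\delta$ of length $m$ is a pattern of $\tau^\varepsilon$ if there are $i_1<\dots<i_m$ with $\tau_{i_1}\cdots\tau_{i_m}$ order-isomorphic to $\sigma$ and, for each $j$, $\delta_j\in\{+,-\}$ implies $\varepsilon_{i_j}=\delta_j$. -}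

module Defs where

open import Data.Nat using (ℕ; zero; suc; _+_; _≤_; _<_)
open import Data.Fin using (Fin; toℕ)
open import Data.Product using (Σ; _×_; ∃; ∃-syntax; _,_)
open import Data.Sum using (_⊎_)
open import Relation.Nullary using (¬_)
open import Relation.Binary.PropositionalEquality using (_≡_; _≢_)
open import Function.Definitions using (Injective)
open import Function.Bundles using (_⇔_)

data Deco : Set where
  plus minus bullet : Deco

flipD : Deco → Deco
flipD plus   = minus
flipD minus  = plus
flipD bullet = bullet

-- A (raw) decorated word of length n: positions Fin n (0-based),
-- values in Fin n (value v encodes the paper's value v+1), decorations.
record Raw (n : ℕ) : Set where
  constructor mkRaw
  field
    perm : Fin n → Fin n
    dec  : Fin n → Deco
open Raw public

-- a peg permutation: the underlying word is a permutation
-- (an injective self-map of Fin n, hence a bijection)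
IsPeg : ∀ {n} → Raw n → Set
IsPeg ρ = Injective _≡_ _≡_ (perm ρ)

-- equality of peg permutations (possibly of different lengths a priori)
data _≅_ : ∀ {m n} → Raw m → Raw n → Set where
  same : ∀ {n} {ρ τ : Raw n} →
         (∀ i → perm ρ i ≡ perm τ i) → (∀ i → dec ρ i ≡ dec τ i) → ρ ≅ τ

IsReversal : ∀ {n} → Raw n → Raw n → Set
IsReversal {n} ρ τ = Σ (Fin n) λ i → Σ (Fin n) λ j → (toℕ i ≤ toℕ j ×
  ((p q : Fin n) → toℕ i ≤ toℕ p → toℕ p ≤ toℕ j → toℕ p + toℕ q ≡ toℕ i + toℕ j →
     (perm τ p ≡ perm ρ q × dec τ p ≡ flipD (dec ρ q))) ×
  ((p : Fin n) → ¬ (toℕ i ≤ toℕ p × toℕ p ≤ toℕ j) →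
     (perm τ p ≡ perm ρ p × dec τ p ≡ dec ρ p)))

IsSorted : ∀ {n} → Raw n → Set
IsSorted {n} ρ = (p : Fin n) → perm ρ p ≡ p × dec ρ p ≢ minus

-- SortableIn j ρ : ρ can be sorted using at most j reversals (rd ρ ≤ j)
SortableIn : ∀ {n} → ℕ → Raw n → Set
SortableIn zero    ρ = IsSorted ρ
SortableIn (suc j) ρ = IsSorted ρ ⊎ (∃[ τ ] (IsReversal ρ τ × SortableIn j τ))

InB : ∀ {n} → ℕ → Raw n → Set
InB k ρ = IsPeg ρ × SortableIn k ρ

IsPattern : ∀ {m n} → Raw m → Raw n → Set
IsPattern {m} {n} σ τ = Σ (Fin m → Fin n) λ f →
  ((a b : Fin m) → toℕ a < toℕ b → toℕ (f a) < toℕ (f b)) ×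
  ((a b : Fin m) → (toℕ (perm σ a) < toℕ (perm σ b)) ⇔ (toℕ (perm τ (f a)) < toℕ (perm τ (f b)))) ×
  ((a : Fin m) → dec σ a ≢ bullet → dec τ (f a) ≡ dec σ a)

IsProperPattern : ∀ {m n} → Raw m → Raw n → Set
IsProperPattern σ τ = IsPattern σ τ × ¬ (σ ≅ τ)

IsBasisElt : ∀ {n} → ℕ → Raw n → Set
IsBasisElt {n} k π = IsPeg π × ¬ InB k π ×
  (∀ {m} (σ : Raw m) → IsPeg σ → IsProperPattern σ π → InB k σ)

IncStep : ∀ {n} → Raw n → Fin n → Fin n → Set
IncStep ρ p q = toℕ q ≡ suc (toℕ p) × toℕ (perm ρ q) ≡ suc (toℕ (perm ρ p)) ×
                dec ρ p ≢ minus × dec ρ q ≢ minus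

DecStep : ∀ {n} → Raw n → Fin n → Fin n → Set
DecStep ρ p q = toℕ q ≡ suc (toℕ p) × toℕ (perm ρ p) ≡ suc (toℕ (perm ρ q)) ×
                dec ρ p ≢ plus × dec ρ q ≢ plus

InRange : ∀ {n} → Fin n → Fin n → Fin n → Set
InRange i j p = toℕ i ≤ toℕ p × toℕ p ≤ toℕ j

-- the factor i..j is an increasing strip (maximal)
IsIncStrip : ∀ {n} → Raw n → Fin n → Fin n → Set
IsIncStrip {n} ρ i j = toℕ i ≤ toℕ j ×
  ((p : Fin n) → InRange i j p → dec ρ p ≢ minus) ×
  ((p q : Fin n) → InRange i j p → InRange i j q → toℕ q ≡ suc (toℕ p) →
     toℕ (perm ρ q) ≡ suc (toℕ (perm ρ p))) ×
  ¬ (∃[ p ] IncStep ρ p i) × ¬ (∃[ q ] IncStep ρ j q)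

IsDecStrip : ∀ {n} → Raw n → Fin n → Fin n → Set
IsDecStrip {n} ρ i j = toℕ i ≤ toℕ j ×
  ((p : Fin n) → InRange i j p → dec ρ p ≢ plus) ×
  ((p q : Fin n) → InRange i j p → InRange i j q → toℕ q ≡ suc (toℕ p) →
     toℕ (perm ρ p) ≡ suc (toℕ (perm ρ q))) ×
  ¬ (∃[ p ] DecStep ρ p i) × ¬ (∃[ q ] DecStep ρ j q)

IsStrip : ∀ {n} → Raw n → Fin n → Fin n → Set
IsStrip ρ i j = IsIncStrip ρ i j ⊎ IsDecStrip ρ i j

IsCompact : ∀ {n} → Raw n → Set
IsCompact {n} ρ = (i j : Fin n) → IsStrip ρ i j →
  i ≡ j ⊎ ((p : Fin n) → InRange i j p → dec ρ p ≡ bullet)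

{-# OPTIONS --safe #-}
-- Suppose a strip of length at least two of the basis element π contains an
-- entry decorated + (increasing strip) or − (decreasing strip). That entry and
-- a neighbour in the strip form a block: two adjacent positions with
-- consecutive values. Deleting the neighbour leaves a proper pattern σ, so
-- rd σ ≤ k, and π is σ with its signed entry inflated back into the block.
-- Every reversal of σ lifts to a reversal of π carrying the block along
-- (turned over when the reversal covers it), and when σ is sorted the sign at
-- the inflated entry forces the block to be increasing, so π is sorted too.
-- Hence rd π ≤ rd σ ≤ k, a contradiction.
module Submission where

open import Defs
open import Data.Nat using (ℕ; zero; suc; pred; _+_; _∸_; _≤_; _<_; s≤s; _≤?_; _<?_)
open import Data.Nat.Properties
open import Data.Fin using (Fin; toℕ; fromℕ<; fromℕ; punchIn; punchOut) renaming (zero to fzero; suc to fsuc)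
open import Data.Fin.Properties
  using (toℕ-fromℕ<; toℕ-injective; toℕ≤pred[n]; all?; ¬∀⟶∃¬;
         punchIn-injective; punchInᵢ≢i; punchIn-cancel-≤; punchOut-injective; punchOut-mono-≤; punchOut-cancel-≤)
  renaming (_≟_ to _≟ᶠ_)
open import Data.Product using (Σ; ∃; ∃₂; _×_; _,_; proj₁; proj₂; map₁; map₂)
open import Data.Sum using (_⊎_; inj₁; inj₂) renaming (map to ⊎-map)
open import Data.Empty using (⊥-elim)
open import Data.Bool using (if_then_else_)
open import Function using (_∘_)
open import Function.Bundles using (_⇔_; mk⇔)
open import Relation.Nullary using (¬_; Dec; yes; no; does; contradiction)
open import Relation.Nullary.Decidable using (_×-dec_; _→-dec_; dec-true; dec-false)
open import Relation.Binary.Definitions using (tri<; tri≈; tri>)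
open import Relation.Binary.PropositionalEquality hiding (J)

punchInℕ : ℕ → ℕ → ℕ
punchInℕ zero    v       = suc v
punchInℕ (suc w) zero    = zero
punchInℕ (suc w) (suc v) = suc (punchInℕ w v)

punchOutℕ : ℕ → ℕ → ℕ
punchOutℕ zero    v       = pred v
punchOutℕ (suc i) zero    = zero
punchOutℕ (suc i) (suc v) = suc (punchOutℕ i v)

punchInℕ-< : ∀ {w v} → v < w → punchInℕ w v ≡ v
punchInℕ-< {suc w} {zero}  _       = refl
punchInℕ-< {suc w} {suc v} (s≤s h) = cong suc (punchInℕ-< h)

punchInℕ-≥ : ∀ {w v} → w ≤ v → punchInℕ w v ≡ suc v
punchInℕ-≥ {zero}          _       = refl
punchInℕ-≥ {suc w} {suc v} (s≤s h) = cong suc (punchInℕ-≥ h)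

punchOutℕ-< : ∀ {i v} → v < i → punchOutℕ i v ≡ v
punchOutℕ-< {suc i} {zero}  _       = refl
punchOutℕ-< {suc i} {suc v} (s≤s h) = cong suc (punchOutℕ-< h)

punchOutℕ-> : ∀ {i v} → i < v → punchOutℕ i v ≡ pred v
punchOutℕ-> {zero}  {suc v}       _       = refl
punchOutℕ-> {suc i} {suc (suc v)} (s≤s h) = cong suc (punchOutℕ-> h)

toℕ-punchIn : ∀ {n} (i : Fin (suc n)) (j : Fin n) → toℕ (punchIn i j) ≡ punchInℕ (toℕ i) (toℕ j)
toℕ-punchIn fzero    j        = refl
toℕ-punchIn (fsuc i) fzero    = refl
toℕ-punchIn (fsuc i) (fsuc j) = cong suc (toℕ-punchIn i j)

toℕ-punchOut : ∀ {n} {i j : Fin (suc n)} (i≢j : i ≢ j) → toℕ (punchOut i≢j) ≡ punchOutℕ (toℕ i) (toℕ j)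
toℕ-punchOut {_}     {fzero}  {fzero}  i≢j = contradiction refl i≢j
toℕ-punchOut {_}     {fzero}  {fsuc j} _   = refl
toℕ-punchOut {suc n} {fsuc i} {fzero}  _   = refl
toℕ-punchOut {suc n} {fsuc i} {fsuc j} i≢j = cong suc (toℕ-punchOut (i≢j ∘ cong fsuc))

punchOutℕ-adjacent : ∀ {w v i} → v ≡ w × i ≡ suc w ⊎ v ≡ suc w × i ≡ w → punchOutℕ i v ≡ w
punchOutℕ-adjacent (inj₁ (refl , refl)) = punchOutℕ-< (n<1+n _)
punchOutℕ-adjacent (inj₂ (refl , refl)) = punchOutℕ-> (n<1+n _)

between-w-1+w : ∀ {w i} → i ≡ w ⊎ i ≡ suc w → w ≤ i × i ≤ suc w
between-w-1+w (inj₁ refl) = ≤-refl , n≤1+n _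
between-w-1+w (inj₂ refl) = n≤1+n _ , ≤-refl

punchInℕ-punchOutℕ : ∀ {w i v} → i ≡ w ⊎ i ≡ suc w → v ≢ w → v ≢ suc w →
                     punchInℕ w (punchOutℕ i v) ≡ v
punchInℕ-punchOutℕ {w} {i} {v} i∈ v≢w v≢1+w with <-cmp v w
... | tri< v<w _ _ =
  trans (cong (punchInℕ w) (punchOutℕ-< (<-≤-trans v<w (proj₁ (between-w-1+w i∈))))) (punchInℕ-< v<w)
... | tri≈ _ v≡w _ = contradiction v≡w v≢w
punchInℕ-punchOutℕ {w} {i} {suc v} i∈ v≢w v≢1+w | tri> _ _ w<1+v =
  trans (cong (punchInℕ w) (punchOutℕ-> (≤-<-trans (proj₂ (between-w-1+w i∈)) 1+w<1+v)))
        (punchInℕ-≥ (≤-pred w<1+v))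
  where
  1+w<1+v : suc w < suc v
  1+w<1+v = ≤∧≢⇒< w<1+v (v≢1+w ∘ sym)

-- Positions of a word of length suc m are handled as naturals; out-of-range
-- arguments of clamp are junk, sent to the last position.
clamp : ∀ {m} → ℕ → Fin (suc m)
clamp {m} x with x ≤? m
... | yes x≤m = fromℕ< (s≤s x≤m)
... | no _    = fromℕ m

toℕ-clamp : ∀ {m x} → x ≤ m → toℕ (clamp {m} x) ≡ x
toℕ-clamp {m} {x} x≤m with x ≤? m
... | yes x≤m′ = toℕ-fromℕ< (s≤s x≤m′)
... | no x≰m   = contradiction x≤m x≰m

clamp-toℕ : ∀ {m} (p : Fin (suc m)) → clamp (toℕ p) ≡ p
clamp-toℕ p = toℕ-injective (toℕ-clamp (toℕ≤pred[n] p))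

Entry : Set
Entry = ℕ × Deco

entryᶠ : ∀ {n} → Raw n → Fin n → Entry
entryᶠ ρ p = toℕ (perm ρ p) , dec ρ p

entry : ∀ {m} → Raw (suc m) → ℕ → Entry
entry ρ x = entryᶠ ρ (clamp x)

val : ∀ {m} → Raw (suc m) → ℕ → ℕ
val ρ x = proj₁ (entry ρ x)

deco : ∀ {m} → Raw (suc m) → ℕ → Deco
deco ρ x = proj₂ (entry ρ x)

entry-toℕ : ∀ {m} (ρ : Raw (suc m)) (p : Fin (suc m)) → entry ρ (toℕ p) ≡ entryᶠ ρ p
entry-toℕ ρ p = cong (entryᶠ ρ) (clamp-toℕ p)

val-injective : ∀ {m} {ρ : Raw (suc m)} → IsPeg ρ →
                ∀ {x y} → x ≤ m → y ≤ m → val ρ x ≡ val ρ y → x ≡ y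
val-injective peg x≤m y≤m e =
  trans (sym (toℕ-clamp x≤m)) (trans (cong toℕ (peg (toℕ-injective e))) (toℕ-clamp y≤m))

flipEntry : Entry → Entry
flipEntry = map₂ flipD

punchInEntry : ℕ → Entry → Entry
punchInEntry w = map₁ (punchInℕ w)

mirror : ℕ → ℕ → ℕ → ℕ
mirror I J x = I + J ∸ x

mirror-≤ : ∀ {I J x} → I ≤ x → mirror I J x ≤ J
mirror-≤ {I} {J} I≤x = ≤-trans (∸-monoʳ-≤ (I + J) I≤x) (≤-reflexive (m+n∸m≡n I J))

mirror-≥ : ∀ {I J x} → x ≤ J → I ≤ mirror I J x
mirror-≥ {I} x≤J = m+n≤o⇒m≤o∸n I (+-monoʳ-≤ I x≤J)

mirror-involutive : ∀ {I J x} → x ≤ J → mirror I J (mirror I J x) ≡ x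
mirror-involutive {I} {J} x≤J = m∸[m∸n]≡n (≤-trans x≤J (m≤n+m J I))

mirror-sucʳ : ∀ {I J x} → x ≤ J → mirror I (suc J) x ≡ suc (mirror I J x)
mirror-sucʳ {I} {J} {x} x≤J = trans (cong (_∸ x) (+-suc I J)) (+-∸-assoc 1 (≤-trans x≤J (m≤n+m J I)))

mirror-sucʳ-suc : ∀ I J x → mirror I (suc J) (suc x) ≡ mirror I J x
mirror-sucʳ-suc I J x = cong (_∸ suc x) (+-suc I J)

<-mirror : ∀ {I J a x} → a ≤ J → x < mirror I J a → a < mirror I J x
<-mirror {I} {J} {a} {x} a≤J x<a′ =
  subst (_< mirror I J x) (mirror-involutive {I} a≤J) (∸-monoʳ-< x<a′ (m∸n≤m (I + J) a))

mirror-< : ∀ {I J a x} → x ≤ J → mirror I J a < x → mirror I J x < a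
mirror-< {I} {J} {a} {x} x≤J a′<x with a ≤? I + J
... | yes a≤I+J = subst (mirror I J x <_) (m∸[m∸n]≡n a≤I+J) (∸-monoʳ-< a′<x (≤-trans x≤J (m≤n+m J I)))
... | no a≰I+J  = ≤-<-trans (m∸n≤m (I + J) x) (≰⇒> a≰I+J)

inRange? : ∀ I J x → Dec (I ≤ x × x ≤ J)
inRange? I J x = (I ≤? x) ×-dec (x ≤? J)

outOfRange : ∀ {I J x} → ¬ (I ≤ x × x ≤ J) → x < I ⊎ J < x
outOfRange {I} {J} {x} ∉ with I ≤? x | x ≤? J
... | no I≰x | _      = inj₁ (≰⇒> I≰x)
... | yes _  | no x≰J = inj₂ (≰⇒> x≰J)
... | yes I≤x | yes x≤J = contradiction (I≤x , x≤J) ∉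

outOfRange⇒∉ : ∀ {I J x} → x < I ⊎ J < x → ¬ (I ≤ x × x ≤ J)
outOfRange⇒∉ (inj₁ x<I) (I≤x , _) = <⇒≱ x<I I≤x
outOfRange⇒∉ (inj₂ J<x) (_ , x≤J) = <⇒≱ J<x x≤J

record Reverses {m} (ρ τ : Raw (suc m)) (I J : ℕ) : Set where
  field
    I≤J     : I ≤ J
    J≤m     : J ≤ m
    inside  : ∀ x → I ≤ x → x ≤ J → entry τ x ≡ flipEntry (entry ρ (mirror I J x))
    outside : ∀ x → x ≤ m → x < I ⊎ J < x → entry τ x ≡ entry ρ x

reversal⇒reverses : ∀ {m} {ρ τ : Raw (suc m)} (r : IsReversal ρ τ) →
                    Reverses ρ τ (toℕ (proj₁ r)) (toℕ (proj₁ (proj₂ r)))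
reversal⇒reverses {m} {ρ} {τ} (i , j , i≤j , hin , hout) = record
  { I≤J = i≤j ; J≤m = toℕ≤pred[n] j ; inside = inside ; outside = outside }
  where
  I J : ℕ
  I = toℕ i
  J = toℕ j
  inside : ∀ x → I ≤ x → x ≤ J → entry τ x ≡ flipEntry (entry ρ (mirror I J x))
  inside x I≤x x≤J with hin (clamp x) (clamp (mirror I J x))
                           (subst (I ≤_) (sym x′≡x) I≤x) (subst (_≤ J) (sym x′≡x) x≤J)
                           (trans (cong₂ _+_ x′≡x y′≡y) (m+[n∸m]≡n (≤-trans x≤J (m≤n+m J I))))
    where
    x′≡x : toℕ (clamp {m} x) ≡ x
    x′≡x = toℕ-clamp (≤-trans x≤J (toℕ≤pred[n] j))
    y′≡y : toℕ (clamp {m} (mirror I J x)) ≡ mirror I J x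
    y′≡y = toℕ-clamp (≤-trans (mirror-≤ {J = J} I≤x) (toℕ≤pred[n] j))
  ... | p≡ , d≡ = cong₂ _,_ (cong toℕ p≡) d≡
  outside : ∀ x → x ≤ m → x < I ⊎ J < x → entry τ x ≡ entry ρ x
  outside x x≤m x∉
    with hout (clamp x) (subst (λ y → ¬ (I ≤ y × y ≤ J)) (sym (toℕ-clamp x≤m)) (outOfRange⇒∉ x∉))
  ... | p≡ , d≡ = cong₂ _,_ (cong toℕ p≡) d≡

reverse : ∀ {n} → Raw (suc n) → ℕ → ℕ → Raw (suc n)
reverse ρ I J = mkRaw
  (λ p → if does (inRange? I J (toℕ p)) then perm ρ (clamp (mirror I J (toℕ p))) else perm ρ p)
  (λ p → if does (inRange? I J (toℕ p)) then flipD (dec ρ (clamp (mirror I J (toℕ p)))) else dec ρ p)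

reverse-isReversal : ∀ {n} (ρ : Raw (suc n)) (i j : Fin (suc n)) → toℕ i ≤ toℕ j →
                     IsReversal ρ (reverse ρ (toℕ i) (toℕ j))
reverse-isReversal {n} ρ i j i≤j = i , j , i≤j , inside , outside
  where
  I J : ℕ
  I = toℕ i
  J = toℕ j
  inside : (p q : Fin (suc n)) → I ≤ toℕ p → toℕ p ≤ J → toℕ p + toℕ q ≡ I + J →
           perm (reverse ρ I J) p ≡ perm ρ q × dec (reverse ρ I J) p ≡ flipD (dec ρ q)
  inside p q I≤p p≤J p+q≡I+J rewrite dec-true (inRange? I J (toℕ p)) (I≤p , p≤J) =
    cong (perm ρ) mirror-p , cong (flipD ∘ dec ρ) mirror-p
    where
    mirror-p : clamp (mirror I J (toℕ p)) ≡ q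
    mirror-p = begin
      clamp (I + J ∸ toℕ p)          ≡⟨ cong (clamp ∘ (_∸ toℕ p)) p+q≡I+J ⟨
      clamp (toℕ p + toℕ q ∸ toℕ p)  ≡⟨ cong clamp (m+n∸m≡n (toℕ p) (toℕ q)) ⟩
      clamp (toℕ q)                  ≡⟨ clamp-toℕ q ⟩
      q                              ∎
      where open ≡-Reasoning
  outside : (p : Fin (suc n)) → ¬ (I ≤ toℕ p × toℕ p ≤ J) →
            perm (reverse ρ I J) p ≡ perm ρ p × dec (reverse ρ I J) p ≡ dec ρ p
  outside p ∉ rewrite dec-false (inRange? I J (toℕ p)) ∉ = refl , refl

reversalAt : ∀ {n} (ρ : Raw (suc n)) {I J} → I ≤ J → J ≤ n →
             ∃ λ τ → IsReversal ρ τ × Reverses ρ τ I J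
reversalAt ρ {I} {J} I≤J J≤n =
  _ , subst₂ (λ I J → IsReversal ρ (reverse ρ I J) × Reverses ρ (reverse ρ I J) I J) I′≡I J′≡J
             (rev , reversal⇒reverses rev)
  where
  I′≡I : toℕ (clamp I) ≡ I
  I′≡I = toℕ-clamp (≤-trans I≤J J≤n)
  J′≡J : toℕ (clamp J) ≡ J
  J′≡J = toℕ-clamp J≤n
  rev : IsReversal ρ (reverse ρ (toℕ (clamp I)) (toℕ (clamp J)))
  rev = reverse-isReversal ρ (clamp I) (clamp J) (subst₂ _≤_ (sym I′≡I) (sym J′≡J) I≤J)

data Ori : Set where
  up down : Ori

flipO : Ori → Ori
flipO up   = down
flipO down = up

sign : Ori → Deco
sign up   = plus
sign down = minus

flipD-sign : ∀ o → flipD (sign o) ≡ sign (flipO o)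
flipD-sign up   = refl
flipD-sign down = refl

flipD-involutive : ∀ d → flipD (flipD d) ≡ d
flipD-involutive plus   = refl
flipD-involutive minus  = refl
flipD-involutive bullet = refl

flipD-≢ : ∀ {d e} → e ≢ flipD d → flipD e ≢ d
flipD-≢ {d} {e} e≢ eq = e≢ (trans (sym (flipD-involutive e)) (cong flipD eq))

Adjacent : Ori → ℕ → ℕ → ℕ → Set
Adjacent up   w p q = p ≡ w × q ≡ suc w
Adjacent down w p q = p ≡ suc w × q ≡ w

adjacent-values : ∀ {o w p q} → Adjacent o w p q → p ≡ w × q ≡ suc w ⊎ p ≡ suc w × q ≡ w
adjacent-values {up}   = inj₁
adjacent-values {down} = inj₂

BlockAt : Ori → ℕ → Entry → Entry → Set
BlockAt o w (p , e) (q , f) = Adjacent o w p q × e ≢ sign (flipO o) × f ≢ sign (flipO o)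

blockAt-flip : ∀ o {w e₁ e₂} → BlockAt o w e₁ e₂ → BlockAt (flipO o) w (flipEntry e₂) (flipEntry e₁)
blockAt-flip up   ((p≡ , q≡) , e≢ , f≢) = (q≡ , p≡) , flipD-≢ f≢ , flipD-≢ e≢
blockAt-flip down ((p≡ , q≡) , e≢ , f≢) = (q≡ , p≡) , flipD-≢ f≢ , flipD-≢ e≢

Matches : ∀ {m} → Raw (suc (suc m)) → Raw (suc m) → ℕ → ℕ → ℕ → Set
Matches π σ w y x = entry π y ≡ punchInEntry w (entry σ x)

-- π is σ with its entry a, of value w and decoration sign o, blown up into
-- the block of adjacent positions a, a+1 carrying the values w, w+1 in
-- direction o; the other values of σ are renumbered around the block.
record Inflation {m} (σ : Raw (suc m)) (π : Raw (suc (suc m))) : Set where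
  field
    a      : ℕ
    a≤m    : a ≤ m
    o      : Ori
    w      : ℕ
    centre : entry σ a ≡ (w , sign o)
    block  : BlockAt o w (entry π a) (entry π (suc a))
    left   : ∀ x → x < a → Matches π σ w x x
    right  : ∀ x → a < x → x ≤ m → Matches π σ w (suc x) x

module _ {m} {σ σ′ : Raw (suc m)} {π π′ : Raw (suc (suc m))} {I J I′ J′ w : ℕ}
         (R : Reverses σ σ′ I J) (R′ : Reverses π π′ I′ J′) where
  private
    module R  = Reverses R
    module R′ = Reverses R′

  -- The middle step is definitional: flipEntry and punchInEntry act on
  -- different components of an entry.
  matches-mirror : ∀ {x y} → I ≤ x → x ≤ J → I′ ≤ y → y ≤ J′ →
                   Matches π σ w (mirror I′ J′ y) (mirror I J x) → Matches π′ σ′ w y x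
  matches-mirror {x} {y} I≤x x≤J I′≤y y≤J′ match = begin
    entry π′ y                                           ≡⟨ R′.inside y I′≤y y≤J′ ⟩
    flipEntry (entry π (mirror I′ J′ y))                 ≡⟨ cong flipEntry match ⟩
    punchInEntry w (flipEntry (entry σ (mirror I J x)))  ≡⟨ cong (punchInEntry w) (R.inside x I≤x x≤J) ⟨
    punchInEntry w (entry σ′ x)                          ∎
    where open ≡-Reasoning

  matches-fixed : ∀ {x y} → x ≤ m → x < I ⊎ J < x → y ≤ suc m → y < I′ ⊎ J′ < y →
                  Matches π σ w y x → Matches π′ σ′ w y x
  matches-fixed {x} {y} x≤m x∉ y≤1+m y∉ match = begin
    entry π′ y                   ≡⟨ R′.outside y y≤1+m y∉ ⟩
    entry π y                    ≡⟨ match ⟩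
    punchInEntry w (entry σ x)   ≡⟨ cong (punchInEntry w) (R.outside x x≤m x∉) ⟨
    punchInEntry w (entry σ′ x)  ∎
    where open ≡-Reasoning

-- A reversal of σ on I..J lifts to the reversal of π on I..J, on I+1..J+1 or
-- on I..J+1 according as it lies before, after or across the block; in the
-- last case the block is turned over and moves to position mirror I J a.
module LiftReversal {m} {σ σ′ : Raw (suc m)} {π : Raw (suc (suc m))} (inf : Inflation σ π)
                    {I J} (R : Reverses σ σ′ I J) where
  open Inflation inf
  private module R = Reverses R

  Lifted : Set
  Lifted = ∃ λ π′ → IsReversal π π′ × Inflation σ′ π′

  reversalBeforeBlock : J < a → Lifted
  reversalBeforeBlock J<a with reversalAt π R.I≤J (m≤n⇒m≤1+n R.J≤m)
  ... | π′ , rev , R′ = π′ , rev , record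
    { a = a ; a≤m = a≤m ; o = o ; w = w
    ; centre = trans (R.outside a a≤m (inj₂ J<a)) centre
    ; block  = subst₂ (BlockAt o w) (sym (R′.outside a (m≤n⇒m≤1+n a≤m) (inj₂ J<a)))
                 (sym (R′.outside (suc a) (s≤s a≤m) (inj₂ (m<n⇒m<1+n J<a)))) block
    ; left   = left′
    ; right  = λ x a<x x≤m → matches-fixed R R′ x≤m (inj₂ (<-trans J<a a<x))
                 (s≤s x≤m) (inj₂ (m<n⇒m<1+n (<-trans J<a a<x))) (right x a<x x≤m)
    }
    where
    module R′ = Reverses R′
    left′ : ∀ x → x < a → Matches π′ σ′ w x x
    left′ x x<a with inRange? I J x
    ... | yes (I≤x , x≤J) =
      matches-mirror R R′ I≤x x≤J I≤x x≤J (left _ (≤-<-trans (mirror-≤ {J = J} I≤x) J<a))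
    ... | no x∉ = matches-fixed R R′ x≤m (outOfRange x∉) (m≤n⇒m≤1+n x≤m) (outOfRange x∉) (left x x<a)
      where
      x≤m : x ≤ m
      x≤m = ≤-trans (<⇒≤ x<a) a≤m

  reversalAfterBlock : a < I → Lifted
  reversalAfterBlock a<I with reversalAt π (s≤s R.I≤J) (s≤s R.J≤m)
  ... | π′ , rev , R′ = π′ , rev , record
    { a = a ; a≤m = a≤m ; o = o ; w = w
    ; centre = trans (R.outside a a≤m (inj₁ a<I)) centre
    ; block  = subst₂ (BlockAt o w) (sym (R′.outside a (m≤n⇒m≤1+n a≤m) (inj₁ (m<n⇒m<1+n a<I))))
                 (sym (R′.outside (suc a) (s≤s a≤m) (inj₁ (s≤s a<I)))) block
    ; left   = λ x x<a → matches-fixed R R′ (≤-trans (<⇒≤ x<a) a≤m) (inj₁ (<-trans x<a a<I))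
                 (m≤n⇒m≤1+n (≤-trans (<⇒≤ x<a) a≤m)) (inj₁ (m<n⇒m<1+n (<-trans x<a a<I))) (left x x<a)
    ; right  = right′
    }
    where
    module R′ = Reverses R′
    right′ : ∀ x → a < x → x ≤ m → Matches π′ σ′ w (suc x) x
    right′ x a<x x≤m with inRange? I J x
    ... | yes (I≤x , x≤J) =
      matches-mirror R R′ I≤x x≤J (s≤s I≤x) (s≤s x≤J)
        (subst (λ y → Matches π σ w y (mirror I J x)) (sym (mirror-sucʳ {I} x≤J))
          (right _ (<-≤-trans a<I (mirror-≥ x≤J)) (≤-trans (mirror-≤ {J = J} I≤x) R.J≤m)))
    ... | no x∉ =
      matches-fixed R R′ x≤m (outOfRange x∉) (s≤s x≤m) (⊎-map s≤s s≤s (outOfRange x∉)) (right x a<x x≤m)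

  reversalAcrossBlock : I ≤ a → a ≤ J → Lifted
  reversalAcrossBlock I≤a a≤J with reversalAt π (m≤n⇒m≤1+n R.I≤J) (s≤s R.J≤m)
  ... | π′ , rev , R′ = π′ , rev , record
    { a = a′ ; a≤m = ≤-trans a′≤J R.J≤m ; o = flipO o ; w = w
    ; centre = centre′
    ; block  = subst₂ (BlockAt (flipO o) w) (sym block-lower) (sym block-upper) (blockAt-flip o block)
    ; left   = left′
    ; right  = right′
    }
    where
    module R′ = Reverses R′
    a′ : ℕ
    a′ = mirror I J a
    a′≤J : a′ ≤ J
    a′≤J = mirror-≤ {J = J} I≤a
    I≤a′ : I ≤ a′
    I≤a′ = mirror-≥ {I} a≤J
    a′′≡a : mirror I J a′ ≡ a
    a′′≡a = mirror-involutive {I} a≤J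
    centre′ : entry σ′ a′ ≡ (w , sign (flipO o))
    centre′ = begin
      entry σ′ a′                          ≡⟨ R.inside a′ I≤a′ a′≤J ⟩
      flipEntry (entry σ (mirror I J a′))  ≡⟨ cong (flipEntry ∘ entry σ) a′′≡a ⟩
      flipEntry (entry σ a)                ≡⟨ cong flipEntry centre ⟩
      (w , flipD (sign o))                 ≡⟨ cong (w ,_) (flipD-sign o) ⟩
      (w , sign (flipO o))                 ∎
      where open ≡-Reasoning
    block-lower : entry π′ a′ ≡ flipEntry (entry π (suc a))
    block-lower = trans (R′.inside a′ I≤a′ (m≤n⇒m≤1+n a′≤J))
      (cong (flipEntry ∘ entry π) (trans (mirror-sucʳ {I} a′≤J) (cong suc a′′≡a)))
    block-upper : entry π′ (suc a′) ≡ flipEntry (entry π a)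
    block-upper = trans (R′.inside (suc a′) (m≤n⇒m≤1+n I≤a′) (s≤s a′≤J))
      (cong (flipEntry ∘ entry π) (trans (mirror-sucʳ-suc I J a′) a′′≡a))
    left′ : ∀ x → x < a′ → Matches π′ σ′ w x x
    left′ x x<a′ with x <? I
    ... | yes x<I =
      matches-fixed R R′ x≤m (inj₁ x<I) (m≤n⇒m≤1+n x≤m) (inj₁ x<I) (left x (<-≤-trans x<I I≤a))
      where
      x≤m : x ≤ m
      x≤m = ≤-trans (<⇒≤ x<I) (≤-trans I≤a a≤m)
    ... | no x≮I = matches-mirror R R′ I≤x x≤J I≤x (m≤n⇒m≤1+n x≤J)
        (subst (λ y → Matches π σ w y (mirror I J x)) (sym (mirror-sucʳ {I} x≤J))
          (right _ (<-mirror {I} a≤J x<a′) (≤-trans (mirror-≤ {J = J} I≤x) R.J≤m)))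
      where
      I≤x : I ≤ x
      I≤x = ≮⇒≥ x≮I
      x≤J : x ≤ J
      x≤J = ≤-trans (<⇒≤ x<a′) a′≤J
    right′ : ∀ x → a′ < x → x ≤ m → Matches π′ σ′ w (suc x) x
    right′ x a′<x x≤m with x ≤? J
    ... | yes x≤J = matches-mirror R R′ I≤x x≤J (m≤n⇒m≤1+n I≤x) (s≤s x≤J)
        (subst (λ y → Matches π σ w y (mirror I J x)) (sym (mirror-sucʳ-suc I J x))
          (left _ (mirror-< {I} x≤J a′<x)))
      where
      I≤x : I ≤ x
      I≤x = ≤-trans I≤a′ (<⇒≤ a′<x)
    ... | no x≰J = matches-fixed R R′ x≤m (inj₂ (≰⇒> x≰J)) (s≤s x≤m) (inj₂ (s≤s (≰⇒> x≰J)))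
        (right x (≤-<-trans a≤J (≰⇒> x≰J)) x≤m)

  liftReversal : Lifted
  liftReversal with J <? a | a <? I
  ... | yes J<a | _       = reversalBeforeBlock J<a
  ... | no _    | yes a<I = reversalAfterBlock a<I
  ... | no J≮a  | no a≮I  = reversalAcrossBlock (≮⇒≥ a≮I) (≮⇒≥ J≮a)

SortedAt : ∀ {m} → Raw (suc m) → ℕ → Set
SortedAt ρ x = val ρ x ≡ x × deco ρ x ≢ minus

sorted⇒sortedAt : ∀ {m} {ρ : Raw (suc m)} → IsSorted ρ → ∀ {x} → x ≤ m → SortedAt ρ x
sorted⇒sortedAt sorted {x} x≤m =
  trans (cong toℕ (proj₁ (sorted (clamp x)))) (toℕ-clamp x≤m) , proj₂ (sorted (clamp x))

sortedAt⇒sorted : ∀ {m} {ρ : Raw (suc m)} → (∀ x → x ≤ m → SortedAt ρ x) → IsSorted ρ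
sortedAt⇒sorted {ρ = ρ} h p with h (toℕ p) (toℕ≤pred[n] p) | entry-toℕ ρ p
... | v≡ , d≢ | e≡ = toℕ-injective (trans (sym (cong proj₁ e≡)) v≡) , d≢ ∘ trans (cong proj₂ e≡)

matches-sortedAt : ∀ {m} {π : Raw (suc (suc m))} {σ : Raw (suc m)} {w x y} →
                   Matches π σ w y x → SortedAt σ x → punchInℕ w x ≡ y → SortedAt π y
matches-sortedAt {w = w} match (v≡ , d≢) shift =
  trans (cong proj₁ match) (trans (cong (punchInℕ w) v≡) shift) , d≢ ∘ trans (sym (cong proj₂ match))

inflation-sorted : ∀ {m} {σ : Raw (suc m)} {π : Raw (suc (suc m))} →
                   Inflation σ π → IsSorted σ → IsSorted π
inflation-sorted {m} {σ} {π} inf σ-sorted = sortedAt⇒sorted sortedπ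
  where
  open Inflation inf
  sortedσ : ∀ {x} → x ≤ m → SortedAt σ x
  sortedσ = sorted⇒sortedAt σ-sorted
  w≡a : w ≡ a
  w≡a = trans (sym (cong proj₁ centre)) (proj₁ (sortedσ a≤m))
  sortedBlock : SortedAt π a × SortedAt π (suc a)
  sortedBlock with o | centre | block
  ... | up   | _      | ((p≡ , q≡) , e≢ , f≢) = (trans p≡ w≡a , e≢) , (trans q≡ (cong suc w≡a) , f≢)
  ... | down | centre | _ = contradiction (cong proj₂ centre) (proj₂ (sortedσ a≤m))
  sortedπ : ∀ t → t ≤ suc m → SortedAt π t
  sortedπ t t≤1+m with <-cmp t a
  ... | tri< t<a _ _ = matches-sortedAt {π = π} {σ} (left t t<a) (sortedσ (≤-trans (<⇒≤ t<a) a≤m))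
                         (trans (cong (λ v → punchInℕ v t) w≡a) (punchInℕ-< t<a))
  ... | tri≈ _ refl _ = proj₁ sortedBlock
  sortedπ (suc x) 1+x≤1+m | tri> _ _ a<1+x with m≤n⇒m<n∨m≡n (≤-pred a<1+x)
  ... | inj₂ refl = proj₂ sortedBlock
  ... | inj₁ a<x = matches-sortedAt {π = π} {σ} (right x a<x (≤-pred 1+x≤1+m)) (sortedσ (≤-pred 1+x≤1+m))
                     (trans (cong (λ v → punchInℕ v x) w≡a) (punchInℕ-≥ (<⇒≤ a<x)))

inflation-sortableIn : ∀ j {m} {σ : Raw (suc m)} {π : Raw (suc (suc m))} →
                       Inflation σ π → SortableIn j σ → SortableIn j π
inflation-sortableIn zero    inf sorted                  = inflation-sorted inf sorted
inflation-sortableIn (suc j) inf (inj₁ sorted)           = inj₁ (inflation-sorted inf sorted)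
inflation-sortableIn (suc j) inf (inj₂ (σ′ , rev , σ′∈))
  with LiftReversal.liftReversal inf (reversal⇒reverses rev)
... | π′ , rev′ , inf′ = inj₂ (π′ , rev′ , inflation-sortableIn j inf′ σ′∈)

punchIn-avoids : ∀ {n} (π : Raw (suc n)) → IsPeg π → ∀ d x → perm π d ≢ perm π (punchIn d x)
punchIn-avoids π peg d x = punchInᵢ≢i d x ∘ sym ∘ peg

delete : ∀ {n} (π : Raw (suc n)) → IsPeg π → Fin (suc n) → Raw n
delete π peg d = mkRaw (λ x → punchOut (punchIn-avoids π peg d x)) (λ x → dec π (punchIn d x))

delete-isPeg : ∀ {n} (π : Raw (suc n)) (peg : IsPeg π) d → IsPeg (delete π peg d)
delete-isPeg π peg d {x} {y} =
  punchIn-injective d x y ∘ peg ∘ punchOut-injective (punchIn-avoids π peg d x) (punchIn-avoids π peg d y)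

delete-isPattern : ∀ {n} (π : Raw (suc n)) (peg : IsPeg π) d → IsPattern (delete π peg d) π
delete-isPattern π peg d = punchIn d , increasing , sameOrder , λ _ _ → refl
  where
  increasing : ∀ x y → toℕ x < toℕ y → toℕ (punchIn d x) < toℕ (punchIn d y)
  increasing x y x<y = ≰⇒> (<⇒≱ x<y ∘ punchIn-cancel-≤ d y x)
  sameOrder : ∀ x y → (toℕ (perm (delete π peg d) x) < toℕ (perm (delete π peg d) y))
                      ⇔ (toℕ (perm π (punchIn d x)) < toℕ (perm π (punchIn d y)))
  sameOrder x y = mk⇔ (λ lt → ≰⇒> (<⇒≱ lt ∘ punchOut-mono-≤ avoids-y avoids-x))
                      (λ lt → ≰⇒> (<⇒≱ lt ∘ punchOut-cancel-≤ avoids-y avoids-x))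
    where
    avoids-x : perm π d ≢ perm π (punchIn d x)
    avoids-x = punchIn-avoids π peg d x
    avoids-y : perm π d ≢ perm π (punchIn d y)
    avoids-y = punchIn-avoids π peg d y

entry-delete : ∀ {m} (π : Raw (suc (suc m))) (peg : IsPeg π) (d : Fin (suc (suc m))) {x} → x ≤ m →
               entry (delete π peg d) x ≡ map₁ (punchOutℕ (val π (toℕ d))) (entry π (punchInℕ (toℕ d) x))
entry-delete {m} π peg d {x} x≤m = begin
  entry (delete π peg d) x
    ≡⟨ cong (_, dec π q) (toℕ-punchOut (punchIn-avoids π peg d (clamp x))) ⟩
  map₁ (punchOutℕ (toℕ (perm π d))) (entryᶠ π q)
    ≡⟨ cong₂ (map₁ ∘ punchOutℕ ∘ proj₁) (entry-toℕ π d) (entry-toℕ π q) ⟨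
  map₁ (punchOutℕ (val π (toℕ d))) (entry π (toℕ q))
    ≡⟨ cong (map₁ (punchOutℕ (val π (toℕ d))) ∘ entry π) toℕ-q ⟩
  map₁ (punchOutℕ (val π (toℕ d))) (entry π (punchInℕ (toℕ d) x)) ∎
  where
  open ≡-Reasoning
  q : Fin (suc (suc m))
  q = punchIn d (clamp x)
  toℕ-q : toℕ q ≡ punchInℕ (toℕ d) x
  toℕ-q = trans (toℕ-punchIn d (clamp x)) (cong (punchInℕ (toℕ d)) (toℕ-clamp x≤m))

-- Deleting position deleted of π contracts the block a, a+1 to the single
-- entry at kept, which carries the sign of the block.
record Contraction {m} (π : Raw (suc (suc m))) : Set where
  field
    a        : ℕ
    a≤m      : a ≤ m
    o        : Ori
    w        : ℕ
    block    : BlockAt o w (entry π a) (entry π (suc a))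
    kept     : ℕ
    deleted  : ℕ
    ends     : kept ≡ a × deleted ≡ suc a ⊎ kept ≡ suc a × deleted ≡ a
    keptSign : deco π kept ≡ sign o

module Contract {m} {π : Raw (suc (suc m))} (peg : IsPeg π) (c : Contraction π) where
  open Contraction c

  a≤deleted≤1+a : a ≤ deleted × deleted ≤ suc a
  a≤deleted≤1+a with ends
  ... | inj₁ (_ , d≡1+a) = subst (λ d → a ≤ d × d ≤ suc a) (sym d≡1+a) (n≤1+n a , ≤-refl)
  ... | inj₂ (_ , d≡a)   = subst (λ d → a ≤ d × d ≤ suc a) (sym d≡a) (≤-refl , n≤1+n a)

  d : Fin (suc (suc m))
  d = clamp deleted

  σ : Raw (suc m)
  σ = delete π peg d

  entryσ : ∀ {x} → x ≤ m → entry σ x ≡ map₁ (punchOutℕ (val π deleted)) (entry π (punchInℕ deleted x))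
  entryσ {x} x≤m = subst (λ d′ → entry σ x ≡ map₁ (punchOutℕ (val π d′)) (entry π (punchInℕ d′ x)))
    (toℕ-clamp (≤-trans (proj₂ a≤deleted≤1+a) (s≤s a≤m))) (entry-delete π peg d x≤m)

  kept-position : punchInℕ deleted a ≡ kept
  kept-position with ends
  ... | inj₁ (k≡a , d≡1+a) =
    trans (cong (λ s → punchInℕ s a) d≡1+a) (trans (punchInℕ-< (n<1+n a)) (sym k≡a))
  ... | inj₂ (k≡1+a , d≡a) =
    trans (cong (λ s → punchInℕ s a) d≡a) (trans (punchInℕ-≥ ≤-refl) (sym k≡1+a))

  private
    transport : ∀ {s t v} → t ≡ s → val π s ≡ v → val π t ≡ v
    transport t≡s = trans (cong (val π) t≡s)

    same-value : ∀ {t s v} → t ≤ suc m → s ≤ suc m → val π s ≡ v → val π t ≡ v → t ≡ s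
    same-value t≤1+m s≤1+m s↦v t↦v = val-injective {ρ = π} peg t≤1+m s≤1+m (trans t↦v (sym s↦v))

  values : val π kept ≡ w × val π deleted ≡ suc w ⊎ val π kept ≡ suc w × val π deleted ≡ w
  values with ends | adjacent-values (proj₁ block)
  ... | inj₁ (k≡a , d≡1+a)  | inj₁ (p≡ , q≡) = inj₁ (transport k≡a p≡ , transport d≡1+a q≡)
  ... | inj₁ (k≡a , d≡1+a)  | inj₂ (p≡ , q≡) = inj₂ (transport k≡a p≡ , transport d≡1+a q≡)
  ... | inj₂ (k≡1+a , d≡a) | inj₁ (p≡ , q≡) = inj₂ (transport k≡1+a q≡ , transport d≡a p≡)
  ... | inj₂ (k≡1+a , d≡a) | inj₂ (p≡ , q≡) = inj₁ (transport k≡1+a q≡ , transport d≡a p≡)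

  deleted-value : val π deleted ≡ w ⊎ val π deleted ≡ suc w
  deleted-value with values
  ... | inj₁ (_ , v≡) = inj₂ v≡
  ... | inj₂ (_ , v≡) = inj₁ v≡

  outside-values : ∀ {t} → t ≤ suc m → t ≢ a → t ≢ suc a → val π t ≢ w × val π t ≢ suc w
  outside-values {t} t≤1+m t≢a t≢1+a with adjacent-values (proj₁ block)
  ... | inj₁ (p≡ , q≡) =
    (t≢a ∘ same-value t≤1+m (m≤n⇒m≤1+n a≤m) p≡) , (t≢1+a ∘ same-value t≤1+m (s≤s a≤m) q≡)
  ... | inj₂ (p≡ , q≡) =
    (t≢1+a ∘ same-value t≤1+m (s≤s a≤m) q≡) , (t≢a ∘ same-value t≤1+m (m≤n⇒m≤1+n a≤m) p≡)

  matches-outside : ∀ {t x} → x ≤ m → t ≤ suc m → punchInℕ deleted x ≡ t → t ≢ a → t ≢ suc a →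
                    Matches π σ w t x
  matches-outside {t} {x} x≤m t≤1+m x↦t t≢a t≢1+a = begin
    entry π t
      ≡⟨ cong (_, deco π t) (punchInℕ-punchOutℕ deleted-value (proj₁ t-outside) (proj₂ t-outside)) ⟨
    punchInEntry w (map₁ (punchOutℕ (val π deleted)) (entry π t))
      ≡⟨ cong (punchInEntry w ∘ map₁ (punchOutℕ (val π deleted)) ∘ entry π) x↦t ⟨
    punchInEntry w (map₁ (punchOutℕ (val π deleted)) (entry π (punchInℕ deleted x)))
      ≡⟨ cong (punchInEntry w) (entryσ x≤m) ⟨
    punchInEntry w (entry σ x) ∎
    where
    open ≡-Reasoning
    t-outside : val π t ≢ w × val π t ≢ suc w
    t-outside = outside-values t≤1+m t≢a t≢1+a

  inflation : Inflation σ π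
  inflation = record
    { a = a ; a≤m = a≤m ; o = o ; w = w ; block = block
    ; centre = trans (entryσ a≤m) (trans (cong (map₁ (punchOutℕ (val π deleted)) ∘ entry π) kept-position)
                 (cong₂ _,_ (punchOutℕ-adjacent values) keptSign))
    ; left   = λ x x<a → matches-outside (≤-trans (<⇒≤ x<a) a≤m) (m≤n⇒m≤1+n (≤-trans (<⇒≤ x<a) a≤m))
                 (punchInℕ-< (<-≤-trans x<a (proj₁ a≤deleted≤1+a))) (<⇒≢ x<a) (<⇒≢ (m<n⇒m<1+n x<a))
    ; right  = λ x a<x x≤m → matches-outside x≤m (s≤s x≤m)
                 (punchInℕ-≥ (≤-trans (proj₂ a≤deleted≤1+a) a<x))
                 (>⇒≢ (m<n⇒m<1+n a<x)) (>⇒≢ a<x ∘ suc-injective)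
    }

deco-sign : ∀ {o e} → e ≢ sign (flipO o) → e ≢ bullet → e ≡ sign o
deco-sign {up}   {plus}   _  _   = refl
deco-sign {up}   {minus}  e≢ _   = contradiction refl e≢
deco-sign {down} {plus}   e≢ _   = contradiction refl e≢
deco-sign {down} {minus}  _  _   = refl
deco-sign {_}    {bullet} _  e≢• = contradiction refl e≢•

clamp-inRange : ∀ {n} {i j : Fin (suc n)} {x} → toℕ i ≤ x → x ≤ toℕ j → InRange i j (clamp x)
clamp-inRange {i = i} {j} I≤x x≤J =
  subst (λ y → toℕ i ≤ y × y ≤ toℕ j) (sym (toℕ-clamp (≤-trans x≤J (toℕ≤pred[n] j)))) (I≤x , x≤J)

toℕ-clamp-suc : ∀ {n x} → suc x ≤ n → toℕ (clamp {n} (suc x)) ≡ suc (toℕ (clamp {n} x))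
toℕ-clamp-suc x<n = trans (toℕ-clamp x<n) (cong suc (sym (toℕ-clamp (<⇒≤ x<n))))

strip-orientation : ∀ {n} {π : Raw (suc n)} {i j} → IsStrip π i j → Σ Ori λ o →
  (∀ p → InRange i j p → dec π p ≢ sign (flipO o)) ×
  (∀ x → toℕ i ≤ x → suc x ≤ toℕ j → ∃ λ w → Adjacent o w (val π x) (val π (suc x)))
strip-orientation {π = π} {i} {j} (inj₁ (_ , signs , steps , _)) = up , signs , λ x I≤x x<J →
  val π x , refl , steps (clamp x) (clamp (suc x)) (clamp-inRange I≤x (<⇒≤ x<J))
                     (clamp-inRange (m≤n⇒m≤1+n I≤x) x<J) (toℕ-clamp-suc (≤-trans x<J (toℕ≤pred[n] j)))
strip-orientation {π = π} {i} {j} (inj₂ (_ , signs , steps , _)) = down , signs , λ x I≤x x<J →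
  val π (suc x) , steps (clamp x) (clamp (suc x)) (clamp-inRange I≤x (<⇒≤ x<J))
                    (clamp-inRange (m≤n⇒m≤1+n I≤x) x<J) (toℕ-clamp-suc (≤-trans x<J (toℕ≤pred[n] j))) , refl

adjacent-within : ∀ {I J P} → I < J → I ≤ P → P ≤ J →
                  ∃₂ λ a d → I ≤ a × suc a ≤ J × (P ≡ a × d ≡ suc a ⊎ P ≡ suc a × d ≡ a)
adjacent-within {I} {J} {P} I<J I≤P P≤J with P <? J
... | yes P<J = P , suc P , I≤P , P<J , inj₁ (refl , refl)
adjacent-within {I} {suc a} {P} (s≤s I≤a) I≤P P≤J | no P≮J =
  a , a , I≤a , ≤-refl , inj₂ (≤-antisym P≤J (≮⇒≥ P≮J) , refl)

strip-contraction : ∀ {m} {π : Raw (suc (suc m))} {i j p} → IsStrip π i j → toℕ i < toℕ j →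
                    InRange i j p → dec π p ≢ bullet → Contraction π
strip-contraction {m} {π} {i} {j} {p} strip i<j (I≤p , p≤J) p≢•
  with strip-orientation strip | adjacent-within i<j I≤p p≤J
... | o , signs , steps | a , deleted , I≤a , a<J , ends = record
  { a = a ; a≤m = ≤-pred (≤-trans a<J (toℕ≤pred[n] j)) ; o = o ; w = proj₁ (steps a I≤a a<J)
  ; block = proj₂ (steps a I≤a a<J) , signs (clamp a) (clamp-inRange I≤a (<⇒≤ a<J))
          , signs (clamp (suc a)) (clamp-inRange (m≤n⇒m≤1+n I≤a) a<J)
  ; kept = toℕ p ; deleted = deleted ; ends = ends
  ; keptSign = trans (cong proj₂ (entry-toℕ π p)) (deco-sign (signs p (I≤p , p≤J)) p≢•)
  }

basisElt⇒¬contractible : ∀ {k m} {π : Raw (suc (suc m))} → IsBasisElt k π → ¬ Contraction π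
basisElt⇒¬contractible {k} {π = π} (peg , π∉B , patterns∈B) c =
  π∉B (peg , inflation-sortableIn k inflation (proj₂ (patterns∈B σ σ-isPeg (σ-isPattern , λ ()))))
  where
  open Contract peg c
  σ-isPeg : IsPeg σ
  σ-isPeg = delete-isPeg π peg d
  σ-isPattern : IsPattern σ π
  σ-isPattern = delete-isPattern π peg d

bullet? : (e : Deco) → Dec (e ≡ bullet)
bullet? plus   = no λ ()
bullet? minus  = no λ ()
bullet? bullet = yes refl

inRangeᶠ? : ∀ {n} (i j p : Fin n) → Dec (InRange i j p)
inRangeᶠ? i j p = inRange? (toℕ i) (toℕ j) (toℕ p)

bulletIfInRange? : ∀ {n} (π : Raw n) (i j p : Fin n) → Dec (InRange i j p → dec π p ≡ bullet)
bulletIfInRange? π i j p = inRangeᶠ? i j p →-dec bullet? (dec π p)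

allBullets⊎nonBullet : ∀ {n} (π : Raw n) (i j : Fin n) →
  (∀ p → InRange i j p → dec π p ≡ bullet) ⊎ ∃ λ p → InRange i j p × dec π p ≢ bullet
allBullets⊎nonBullet {n} π i j with all? (bulletIfInRange? π i j)
... | yes bullets = inj₁ bullets
... | no ¬bullets with ¬∀⟶∃¬ n _ (bulletIfInRange? π i j) ¬bullets
... | p , ¬bulletIfIn with inRangeᶠ? i j p
...   | yes p∈ = inj₂ (p , p∈ , λ p• → ¬bulletIfIn (λ _ → p•))
...   | no p∉  = contradiction (λ p∈ → contradiction p∈ p∉) ¬bulletIfIn

strip-< : ∀ {n} {π : Raw n} {i j} → IsStrip π i j → i ≢ j → toℕ i < toℕ j
strip-< (inj₁ (i≤j , _)) i≢j = ≤∧≢⇒< i≤j (i≢j ∘ toℕ-injective)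
strip-< (inj₂ (i≤j , _)) i≢j = ≤∧≢⇒< i≤j (i≢j ∘ toℕ-injective)

mainTheorem13 : (k n : ℕ) (π : Raw n) → IsBasisElt k π → IsCompact π
mainTheorem13 k zero          π basis ()
mainTheorem13 k (suc zero)    π basis fzero fzero strip = inj₁ refl
mainTheorem13 k (suc (suc m)) π basis i j strip with i ≟ᶠ j | allBullets⊎nonBullet π i j
... | yes i≡j | _                    = inj₁ i≡j
... | no _    | inj₁ bullets         = inj₂ bullets
... | no i≢j  | inj₂ (p , p∈ , p≢•) =
  ⊥-elim (basisElt⇒¬contractible basis (strip-contraction strip (strip-< strip i≢j) p∈ p≢•))
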